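{- Let $N\ge1$ and consider the flat clusteron with one violinist in each of rooms $0,1,\dots,N-1$. In every state reachable from it, each room contains at most one violinist, and if $p_1<p_2<\dots<p_N$ are the occupied rooms then $|p_i-(i-1)|\le N-1$ for all $1\le i\le N$; that is, (numbering violinists from left to right, an order which moves can be taken to preserve) no violinist is ever more than $N-1$ rooms away from its original room.
   Context: Rooms are indexed by the integers, room $i$ adjacent to rooms $i\pm1$. A state is a finite placement of indistinguishable violinists in rooms. A move is possible whenever two adjacent rooms $i,i+1$ are both occupied: one violinist leaves room $i$ for the nearest unoccupied room to the left of $i$, and one violinist leaves room $i+1$ for the nearest unoccupied room to the right of $i+1$. Reachable means obtained by a finite (possibly empty) sequence of moves. A flat clusteron is a state in which a set of consecutive rooms each contain exactly one violinist and all other rooms are empty. -}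

module Defs where

open import Data.Nat using (ℕ; zero; suc; _∸_) renaming (_≤_ to _≤ℕ_)
open import Data.Integer using (ℤ; +_; _+_; _-_; _<_; _≤_; ∣_∣; 0ℤ; 1ℤ)
import Data.Integer.Properties as ℤP
open import Data.Bool using (Bool; true; false; if_then_else_; _∨_; _∧_)
open import Data.Product using (Σ; _×_; _,_)
open import Relation.Nullary.Decidable using (⌊_⌋)
open import Relation.Binary.PropositionalEquality using (_≡_)

-- A state: number of violinists in each room (room indices are integers).
State : Set
State = ℤ → ℕ

_==_ : ℤ → ℤ → Bool
x == y = ⌊ x ℤP.≟ y ⌋

AllOccBetween : State → ℤ → ℤ → Set
AllOccBetween s a b = ∀ x → a < x → x < b → 1 ≤ℕ s x

-- The state after the move at (i, i+1), where a is the nearest unoccupied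
-- room to the left of i and b the nearest unoccupied room to the right of i+1.
moved : State → ℤ → ℤ → ℤ → State
moved s i a b x =
  if (x == i) ∨ (x == (i + 1ℤ)) then s x ∸ 1
  else if (x == a) ∨ (x == b) then suc (s x)
  else s x

data Move (s : State) : State → Set where
  move : (i a b : ℤ) →
         1 ≤ℕ s i → 1 ≤ℕ s (i + 1ℤ) →
         a < i → s a ≡ 0 → AllOccBetween s a i →
         i + 1ℤ < b → s b ≡ 0 → AllOccBetween s (i + 1ℤ) b →
         Move s (moved s i a b)

data Reachable (s : State) : State → Set where
  done : Reachable s s
  step : ∀ {t u} → Reachable s t → Move t u → Reachable s u

flat : ℕ → State
flat N x = if ⌊ 0ℤ ℤP.≤? x ⌋ ∧ ⌊ x ℤP.<? + N ⌋ then 1 else 0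

countOcc : State → ℤ → ℕ → ℕ
countOcc s L zero = 0
countOcc s L (suc k) with s (L + + k)
... | zero = countOcc s L k
... | suc _ = suc (countOcc s L k)

module Submission where

-- Number the violinists from the left, starting at 0, so that violinist c starts in room c.  If,
-- counting from a room L with nobody further left, a violinist has e empty and c occupied rooms
-- before it, it sits in room L + e + c, i.e. at displacement L + e.  The invariant is
--     c ≤ N - 1   and   L + e ≤ c ≤ L + e + (N - 1),
-- which forces |L + e| ≤ N - 1 and holds for the flat clusteron (L + e = 0).  A move acts on a
-- maximal run of occupied rooms, all of the same displacement: the violinists between its left end
-- and the emptied pair move one room left, those after the pair one room right, and all of them keep
-- indices between those of the two end violinists of the run.  The constraint is convex enough to
-- pass from these two end violinists to everybody shifted in that way.

open import Data.Nat using (ℕ)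
open import Data.Bool using (if_then_else_)
open import Data.Empty using (⊥-elim)
open import Relation.Binary.Definitions using (DecidableEquality)
open import Relation.Binary.PropositionalEquality
open import Relation.Nullary using (¬_; yes; no)
open import Relation.Nullary.Decidable using (⌊_⌋)

module _ {A : Set} (_≟ᴬ_ : DecidableEquality A) where

  δ : A → A → ℕ
  δ x y = if ⌊ x ≟ᴬ y ⌋ then 1 else 0

  δ-refl : ∀ x → δ x x ≡ 1
  δ-refl x with x ≟ᴬ x
  ... | yes _ = refl
  ... | no x≢x = ⊥-elim (x≢x refl)

  δ-≢ : ∀ {x y} → x ≢ y → δ x y ≡ 0
  δ-≢ {x} {y} x≢y with x ≟ᴬ y
  ... | yes x≡y = ⊥-elim (x≢y x≡y)
  ... | no _ = refl

module Counting where

  open import Data.Nat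
  open import Data.Nat.Properties
  open import Data.Sum using (inj₁; inj₂)
  open import Function using (_∘_)
  open import Algebra.Properties.CommutativeSemigroup +-commutativeSemigroup using (interchange)
  open import Data.Nat.Tactic.RingSolver using (solve)
  open import Data.List using (_∷_; [])

  occ : ℕ → ℕ
  occ zero = 0
  occ (suc _) = 1

  vac : ℕ → ℕ
  vac zero = 1
  vac (suc _) = 0

  occ≤1 : ∀ v → occ v ≤ 1
  occ≤1 zero = z≤n
  occ≤1 (suc _) = s≤s z≤n

  occ-pos : ∀ {v} → 1 ≤ v → occ v ≡ 1
  occ-pos (s≤s _) = refl

  occ≡1⇒pos : ∀ {v} → occ v ≡ 1 → 1 ≤ v
  occ≡1⇒pos {suc _} _ = s≤s z≤n

  occ-≤1 : ∀ {v} → v ≤ 1 → occ v ≡ v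
  occ-≤1 z≤n = refl
  occ-≤1 (s≤s z≤n) = refl

  occ+vac : ∀ v → occ v + vac v ≡ 1
  occ+vac zero = refl
  occ+vac (suc _) = refl

  tally : (ℕ → ℕ) → ℕ → ℕ
  tally F zero = 0
  tally F (suc n) = F n + tally F n

  tally-+ : ∀ F G n → tally (λ k → F k + G k) n ≡ tally F n + tally G n
  tally-+ F G zero = refl
  tally-+ F G (suc n) = trans (cong (F n + G n +_) (tally-+ F G n)) (interchange (F n) (G n) _ _)

  tally-+-+ : ∀ F G H n → tally (λ k → F k + G k + H k) n ≡ tally F n + tally G n + tally H n
  tally-+-+ F G H n = trans (tally-+ (λ k → F k + G k) H n) (cong (_+ tally H n) (tally-+ F G n))

  tally-cong : ∀ {F G} → (∀ k → F k ≡ G k) → ∀ n → tally F n ≡ tally G n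
  tally-cong F≗G zero = refl
  tally-cong F≗G (suc n) = cong₂ _+_ (F≗G n) (tally-cong F≗G n)

  tally-mono : ∀ F {m n} → m ≤ n → tally F m ≤ tally F n
  tally-mono F {n = zero} z≤n = ≤-refl
  tally-mono F {n = suc n} m≤1+n with m≤n⇒m<n∨m≡n m≤1+n
  ... | inj₂ refl = ≤-refl
  ... | inj₁ (s≤s m≤n) = ≤-trans (tally-mono F m≤n) (m≤n+m _ (F n))

  δℕ : ℕ → ℕ → ℕ
  δℕ = δ _≟_

  tally-δ-≥ : ∀ {u n} → n ≤ u → tally (λ k → δℕ k u) n ≡ 0
  tally-δ-≥ {n = zero} _ = refl
  tally-δ-≥ {n = suc n} n<u = cong₂ _+_ (δ-≢ _≟_ (<⇒≢ n<u)) (tally-δ-≥ (<⇒≤ n<u))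

  tally-δ-< : ∀ {u n} → u < n → tally (λ k → δℕ k u) n ≡ 1
  tally-δ-< {u} {suc n} u<1+n with m≤n⇒m<n∨m≡n (≤-pred u<1+n)
  ... | inj₁ u<n = cong₂ _+_ (δ-≢ _≟_ (>⇒≢ u<n)) (tally-δ-< u<n)
  ... | inj₂ refl = cong₂ _+_ (δ-refl _≟_ u) (tally-δ-≥ {u} ≤-refl)

  filled holes : (ℕ → ℕ) → ℕ → ℕ
  filled f = tally (occ ∘ f)
  holes f = tally (vac ∘ f)

  filled+holes : ∀ f n → filled f n + holes f n ≡ n
  filled+holes f zero = refl
  filled+holes f (suc n) =
    trans (interchange (occ (f n)) _ (vac (f n)) _) (cong₂ _+_ (occ+vac (f n)) (filled+holes f n))

  filled-step : ∀ {f n} → 1 ≤ f n → filled f (suc n) ≡ suc (filled f n)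
  filled-step {f} {n} fn with f n
  ... | suc _ = refl

  holes-step : ∀ {f n} → 1 ≤ f n → holes f (suc n) ≡ holes f n
  holes-step {f} {n} fn with f n
  ... | suc _ = refl

  filled-vacant : ∀ {f n} → (∀ k → k < n → f k ≡ 0) → filled f n ≡ 0
  filled-vacant {n = zero} _ = refl
  filled-vacant {f} {suc n} vacant rewrite vacant n ≤-refl =
    filled-vacant {f} (λ k k<n → vacant k (m<n⇒m<1+n k<n))

  filled-run : ∀ {f} d {m} → (∀ j → j < m → 1 ≤ f (d + j)) → filled f (d + m) ≡ m + filled f d
  filled-run {f} d {zero} _ = cong (filled f) (+-identityʳ d)
  filled-run {f} d {suc m} run = begin
    filled f (d + suc m)   ≡⟨ cong (filled f) (+-suc d m) ⟩
    filled f (suc (d + m)) ≡⟨ filled-step {f} (run m ≤-refl) ⟩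
    suc (filled f (d + m)) ≡⟨ cong suc (filled-run d (λ j j<m → run j (m<n⇒m<1+n j<m))) ⟩
    suc (m + filled f d)   ∎
    where open ≡-Reasoning

  holes-run : ∀ {f m n} → m ≤ n → (∀ k → m ≤ k → k < n → 1 ≤ f k) → holes f n ≡ holes f m
  holes-run {n = zero} z≤n _ = refl
  holes-run {f} {n = suc n} m≤1+n run with m≤n⇒m<n∨m≡n m≤1+n
  ... | inj₂ refl = refl
  ... | inj₁ (s≤s m≤n) = trans (holes-step {f} (run n m≤n ≤-refl))
                               (holes-run {f} m≤n (λ k m≤k k<n → run k m≤k (m<n⇒m<1+n k<n)))

  balance-≡ : ∀ {x y p q r t} → p + q ≡ r + t → x + p + q ≡ y + r + t → x ≡ y
  balance-≡ {x} {y} {p} {q} {r} {t} pq≡rt eq = +-cancelʳ-≡ (r + t) x y (begin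
    x + (r + t) ≡⟨ cong (x +_) pq≡rt ⟨
    x + (p + q) ≡⟨ +-assoc x p q ⟨
    x + p + q   ≡⟨ eq ⟩
    y + r + t   ≡⟨ +-assoc y r t ⟩
    y + (r + t) ∎)
    where open ≡-Reasoning

  balance-suc : ∀ {x y p q r t} → p + q ≡ suc (r + t) → x + p + q ≡ y + r + t → suc x ≡ y
  balance-suc {x} {y} {p} {q} {r} {t} pq≡1+rt eq = +-cancelʳ-≡ (r + t) (suc x) y (begin
    suc x + (r + t) ≡⟨ +-suc x (r + t) ⟨
    x + suc (r + t) ≡⟨ cong (x +_) pq≡1+rt ⟨
    x + (p + q)     ≡⟨ +-assoc x p q ⟨
    x + p + q       ≡⟨ eq ⟩
    y + r + t       ≡⟨ +-assoc y r t ⟩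
    y + (r + t)     ∎)
    where open ≡-Reasoning

  balance-swap : ∀ {o v o′ v′ x y z w} → o + v ≡ o′ + v′ → o + x + y ≡ o′ + z + w →
                 v + z + w ≡ v′ + x + y
  balance-swap {o} {v} {o′} {v′} {x} {y} {z} {w} sums eq = +-cancelˡ-≡ (o + x + y) _ _ (begin
    (o + x + y) + (v + z + w)   ≡⟨ solve (o ∷ v ∷ x ∷ y ∷ z ∷ w ∷ []) ⟩
    (o + v) + (x + y + z + w)   ≡⟨ cong (_+ (x + y + z + w)) sums ⟩
    (o′ + v′) + (x + y + z + w) ≡⟨ solve (o′ ∷ v′ ∷ x ∷ y ∷ z ∷ w ∷ []) ⟩
    (o′ + z + w) + (v′ + x + y) ≡⟨ cong (_+ (v′ + x + y)) eq ⟨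
    (o + x + y) + (v′ + x + y)  ∎)
    where open ≡-Reasoning

  Placed : (ℕ → ℕ → Set) → (ℕ → ℕ) → Set
  Placed R f = ∀ n → 1 ≤ f n → R (holes f n) (filled f n)

  record ShiftClosed (R : ℕ → ℕ → Set) : Set where
    field
      shiftˡ : ∀ {e c₀ c₁ c} → R (suc e) c₀ → R (suc e) c₁ → c₀ ≤ c → c < c₁ → R e c
      shiftʳ : ∀ {e c₀ c₁ c} → R e c₀ → R e c₁ → c₀ < c → c ≤ c₁ → R (suc e) c

  -- Rooms α + 1, …, ω are occupied in f, and g arises by emptying ι, ι + 1 and filling α, ω + 1;
  -- the balance records exactly this change of occupancy.
  module BlockMove {f g : ℕ → ℕ} {α ι ω : ℕ} (α<ι : α < ι) (ι<ω : suc ι ≤ ω)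
    (block : ∀ k → α < k → k ≤ ω → 1 ≤ f k)
    (balance : ∀ k → occ (g k) + δℕ k ι + δℕ k (suc ι) ≡ occ (f k) + δℕ k α + δℕ k (suc ω))
    where

    passed : ℕ → ℕ → ℕ
    passed u = tally (λ k → δℕ k u)

    filled-balance : ∀ n → filled g n + passed ι n + passed (suc ι) n
                         ≡ filled f n + passed α n + passed (suc ω) n
    filled-balance n = trans (sym (tally-+-+ (occ ∘ g) _ _ n))
                             (trans (tally-cong balance n) (tally-+-+ (occ ∘ f) _ _ n))

    holes-balance : ∀ n → holes g n + passed α n + passed (suc ω) n
                        ≡ holes f n + passed ι n + passed (suc ι) n
    holes-balance n = balance-swap {filled g n} {holes g n} {filled f n} {holes f n}
      (trans (filled+holes g n) (sym (filled+holes f n))) (filled-balance n)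

    holes-block : ∀ {n} → suc α ≤ n → n ≤ suc ω → holes f n ≡ holes f (suc α)
    holes-block α<n n≤1+ω =
      holes-run {f} α<n (λ k α<k k<n → block k α<k (≤-pred (<-≤-trans k<n n≤1+ω)))

    α<ω : α < ω
    α<ω = <-trans α<ι (<-≤-trans (n<1+n ι) ι<ω)

    module _ {R : ℕ → ℕ → Set} (closed : ShiftClosed R) (placed : Placed R f) where
      open ShiftClosed closed

      holes-≡ : ∀ {e e′ c} → e ≡ e′ → R e c → R e′ c
      holes-≡ {c = c} = subst (λ e → R e c)

      first : R (holes f (suc α)) (filled f (suc α))
      first = placed (suc α) (block (suc α) ≤-refl α<ω)

      last : R (holes f (suc α)) (filled f ω)
      last = holes-≡ (holes-block α<ω (n≤1+n ω)) (placed ω (block ω α<ω ≤-refl))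

      away : ∀ {n} h → passed α n ≡ h → passed ι n ≡ h → passed (suc ι) n ≡ h → passed (suc ω) n ≡ h →
             n ≢ α → n ≢ ι → n ≢ suc ι → n ≢ suc ω → 1 ≤ g n → R (holes g n) (filled g n)
      away {n} h pα pι pι′ pω n≢α n≢ι n≢ι′ n≢ω gn = subst₂ R (sym same-holes) (sym same-filled)
        (placed n (occ≡1⇒pos (trans (sym same-occ) (occ-pos gn))))
        where
        same-occ : occ (g n) ≡ occ (f n)
        same-occ = balance-≡ (cong₂ _+_ (trans (δ-≢ _≟_ n≢ι) (sym (δ-≢ _≟_ n≢α)))
                                        (trans (δ-≢ _≟_ n≢ι′) (sym (δ-≢ _≟_ n≢ω)))) (balance n)
        same-filled : filled g n ≡ filled f n
        same-filled = balance-≡ (cong₂ _+_ (trans pι (sym pα)) (trans pι′ (sym pω))) (filled-balance n)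
        same-holes : holes g n ≡ holes f n
        same-holes = balance-≡ (cong₂ _+_ (trans pα (sym pι)) (trans pω (sym pι′))) (holes-balance n)

      -- The counts are compared at n + 1 rather than n, so that n = α needs no separate case.
      left-part : ∀ {n} → α ≤ n → n < ι → 1 ≤ g n → R (holes g n) (filled g n)
      left-part {n} α≤n n<ι gn = subst (R _) (sym filled-eq)
        (shiftˡ (holes-≡ (sym holes-eq) first) (holes-≡ (sym holes-eq) last)
                (tally-mono (occ ∘ f) (s≤s α≤n)) c<c₁)
        where
        open ≤-Reasoning
        n<ω : n < ω
        n<ω = <-trans n<ι (<-≤-trans (n<1+n ι) ι<ω)
        shift : passed α (suc n) + passed (suc ω) (suc n)
              ≡ suc (passed ι (suc n) + passed (suc ι) (suc n))
        shift = trans (cong₂ _+_ (tally-δ-< (s≤s α≤n)) (tally-δ-≥ (s≤s (<⇒≤ n<ω))))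
                      (sym (cong suc (cong₂ _+_ (tally-δ-≥ n<ι) (tally-δ-≥ (<⇒≤ (s≤s n<ι))))))
        holes-eq : suc (holes g n) ≡ holes f (suc α)
        holes-eq = trans (cong suc (sym (holes-step {g} gn)))
          (trans (balance-suc shift (holes-balance (suc n))) (holes-block (s≤s α≤n) (s≤s (<⇒≤ n<ω))))
        filled-eq : filled g n ≡ filled f (suc n)
        filled-eq = suc-injective (trans (sym (filled-step {g} gn))
                                         (sym (balance-suc shift (sym (filled-balance (suc n))))))
        c<c₁ : filled f (suc n) < filled f ω
        c<c₁ = begin-strict
          filled f (suc n) ≤⟨ tally-mono (occ ∘ f) n<ι ⟩
          filled f ι       <⟨ n<1+n _ ⟩
          suc (filled f ι) ≡⟨ filled-step {f} (block ι α<ι (<⇒≤ ι<ω)) ⟨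
          filled f (suc ι) ≤⟨ tally-mono (occ ∘ f) ι<ω ⟩
          filled f ω       ∎

      right-part : ∀ {n} → suc ι < n → n ≤ suc ω → 1 ≤ g n → R (holes g n) (filled g n)
      right-part {n} ι′<n n≤ω′ gn = holes-≡ (sym holes-eq) (shiftʳ first last c₀<c c≤c₁)
        where
        open ≤-Reasoning
        ι<n : ι < n
        ι<n = <-trans (n<1+n ι) ι′<n
        shift : passed ι n + passed (suc ι) n ≡ suc (passed α n + passed (suc ω) n)
        shift = trans (cong₂ _+_ (tally-δ-< ι<n) (tally-δ-< ι′<n))
                      (sym (cong suc (cong₂ _+_ (tally-δ-< (<-trans α<ι ι<n)) (tally-δ-≥ n≤ω′))))
        holes-eq : holes g n ≡ suc (holes f (suc α))
        holes-eq = trans (sym (balance-suc shift (sym (holes-balance n))))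
                         (cong suc (holes-block (<-trans α<ι ι<n) n≤ω′))
        filled-eq : suc (filled g n) ≡ filled f n
        filled-eq = balance-suc shift (filled-balance n)
        c₀<c : filled f (suc α) < filled g n
        c₀<c = ≤-pred (begin
          suc (suc (filled f (suc α))) ≤⟨ s≤s (s≤s (tally-mono (occ ∘ f) α<ι)) ⟩
          suc (suc (filled f ι))       ≡⟨ cong suc (filled-step {f} (block ι α<ι (<⇒≤ ι<ω))) ⟨
          suc (filled f (suc ι))       ≡⟨ filled-step {f} (block (suc ι) (<-trans α<ι (n<1+n ι)) ι<ω) ⟨
          filled f (suc (suc ι))       ≤⟨ tally-mono (occ ∘ f) ι′<n ⟩
          filled f n                   ≡⟨ filled-eq ⟨
          suc (filled g n)             ∎)
        c≤c₁ : filled g n ≤ filled f ω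
        c≤c₁ = ≤-pred (begin
          suc (filled g n) ≡⟨ filled-eq ⟩
          filled f n       ≤⟨ tally-mono (occ ∘ f) n≤ω′ ⟩
          filled f (suc ω) ≡⟨ filled-step {f} (block ω α<ω ≤-refl) ⟩
          suc (filled f ω) ∎)

      vacated : ∀ {n} → δℕ n ι + δℕ n (suc ι) ≡ suc (δℕ n α + δℕ n (suc ω)) → ¬ 1 ≤ g n
      vacated {n} emptied gn = 1+n≰n (≤-trans
        (≤-reflexive (trans (cong suc (sym (occ-pos gn))) (balance-suc emptied (balance n))))
        (occ≤1 (f n)))

      placed-after : Placed R g
      placed-after n gn with n <? α
      ... | yes n<α = away 0 (tally-δ-≥ (<⇒≤ n<α)) (tally-δ-≥ (<⇒≤ n<ι)) (tally-δ-≥ (<⇒≤ n<ι′))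
                            (tally-δ-≥ (<⇒≤ n<ω′)) (<⇒≢ n<α) (<⇒≢ n<ι) (<⇒≢ n<ι′) (<⇒≢ n<ω′) gn
        where
        n<ι = <-trans n<α α<ι
        n<ι′ = m<n⇒m<1+n n<ι
        n<ω′ = <-≤-trans n<ι′ (m≤n⇒m≤1+n ι<ω)
      ... | no n≮α with n <? ι
      ...   | yes n<ι = left-part (≮⇒≥ n≮α) n<ι gn
      ...   | no n≮ι with n ≤? suc ι
      ...     | yes n≤ι′ with m≤n⇒m<n∨m≡n n≤ι′
      ...       | inj₁ n<ι′ rewrite ≤-antisym (≤-pred n<ι′) (≮⇒≥ n≮ι) = ⊥-elim (vacated emptied gn)
        where
        emptied : δℕ ι ι + δℕ ι (suc ι) ≡ suc (δℕ ι α + δℕ ι (suc ω))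
        emptied = trans (cong₂ _+_ (δ-refl _≟_ ι) (δ-≢ _≟_ (<⇒≢ (n<1+n ι))))
                        (sym (cong suc (cong₂ _+_ (δ-≢ _≟_ (>⇒≢ α<ι))
                                                  (δ-≢ _≟_ (<⇒≢ (m≤n⇒m≤1+n ι<ω))))))
      ...       | inj₂ refl = ⊥-elim (vacated emptied gn)
        where
        emptied : δℕ (suc ι) ι + δℕ (suc ι) (suc ι) ≡ suc (δℕ (suc ι) α + δℕ (suc ι) (suc ω))
        emptied = trans (cong₂ _+_ (δ-≢ _≟_ (>⇒≢ (n<1+n ι))) (δ-refl _≟_ (suc ι)))
                        (sym (cong suc (cong₂ _+_ (δ-≢ _≟_ (>⇒≢ (<-trans α<ι (n<1+n ι))))
                                                  (δ-≢ _≟_ (<⇒≢ (s≤s ι<ω))))))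
      placed-after n gn | no n≮α | no n≮ι | no n≰ι′ with n ≤? suc ω
      ... | yes n≤ω′ = right-part (≰⇒> n≰ι′) n≤ω′ gn
      ... | no n≰ω′ = away 1 (tally-δ-< α<n) (tally-δ-< ι<n) (tally-δ-< ι′<n) (tally-δ-< ω′<n)
                             (>⇒≢ α<n) (>⇒≢ ι<n) (>⇒≢ ι′<n) (>⇒≢ ω′<n) gn
        where
        ω′<n = ≰⇒> n≰ω′
        ι′<n = <-trans (s≤s ι<ω) ω′<n
        ι<n = <-trans (n<1+n ι) ι′<n
        α<n = <-trans α<ι ι<n

open Counting

open import Defs
open import Data.Nat as ℕ using (ℕ; zero; suc; z≤n; s≤s; _∸_) renaming (_≤_ to _≤ℕ_; _<_ to _<ℕ_)
import Data.Nat.Properties as ℕP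
open import Data.Nat.Tactic.RingSolver using (solve)
open import Data.Integer using (ℤ; +_; -[1+_]; _+_; _-_; -_; _<_; _≤_; ∣_∣; 0ℤ; 1ℤ; +≤+; +<+)
import Data.Integer.Properties as ℤP
open import Data.Integer.Tactic.RingSolver using (solve-∀)
open import Algebra.Properties.AbelianGroup ℤP.+-0-abelianGroup using (∙-cancelˡ)
open import Data.Bool using (true; false; _∧_)
open import Data.List using (_∷_; [])
open import Data.Product using (_×_; _,_; ∃)
open import Relation.Binary using (tri<; tri≈; tri>)

+-cancelˡ-≤ : ∀ k {i j} → k + i ≤ k + j → i ≤ j
+-cancelˡ-≤ k {i} {j} k+i≤k+j = subst₂ _≤_ (cancel k i) (cancel k j) (ℤP.+-monoʳ-≤ (- k) k+i≤k+j)
  where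
  cancel : ∀ k i → - k + (k + i) ≡ i
  cancel = solve-∀

+-cancelˡ-< : ∀ k {i j} → k + i < k + j → i < j
+-cancelˡ-< k {i} {j} k+i<k+j = subst₂ _<_ (cancel k i) (cancel k j) (ℤP.+-monoʳ-< (- k) k+i<k+j)
  where
  cancel : ∀ k i → - k + (k + i) ≡ i
  cancel = solve-∀

i<i+1 : ∀ i → i < i + 1ℤ
i<i+1 i = ℤP.suc[i]≤j⇒i<j (ℤP.≤-reflexive (ℤP.+-comm 1ℤ i))

window⇒∣∣≤ : ∀ {D c M} → D ≤ + c → + c ≤ D + + M → c ≤ℕ M → ∣ D ∣ ≤ℕ M
window⇒∣∣≤ {+ d} D≤c _ c≤M = ℕP.≤-trans (ℤP.drop‿+≤+ D≤c) c≤M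
window⇒∣∣≤ { -[1+ d ]} {c} {M} _ c≤D+M _ = ℕP.≤-trans (ℕP.m≤n+m (suc d) c) (ℤP.drop‿+≤+ (begin
  + c + + suc d            ≤⟨ ℤP.+-monoˡ-≤ (+ suc d) c≤D+M ⟩
  -[1+ d ] + + M + + suc d ≡⟨ cancel (+ suc d) (+ M) ⟩
  + M                      ∎))
  where
  open ℤP.≤-Reasoning
  cancel : ∀ x M → - x + M + x ≡ M
  cancel = solve-∀

offset : ∀ {L x} → L ≤ x → ∃ λ k → x ≡ L + + k
offset {L} {x} L≤x =
  ∣ x - L ∣ , trans (split x L) (cong (λ z → L + z) (sym (ℤP.0≤i⇒+∣i∣≡i (ℤP.i≤j⇒0≤j-i L≤x))))
  where
  split : ∀ x L → x ≡ L + (x - L)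
  split = solve-∀

offset-< : ∀ L {m n} → m <ℕ n → L + + m < L + + n
offset-< L m<n = ℤP.+-monoʳ-< L (+<+ m<n)

offset-<⁻¹ : ∀ L {m n} → L + + m < L + + n → m <ℕ n
offset-<⁻¹ L L+m<L+n = ℤP.drop‿+<+ (+-cancelˡ-< L L+m<L+n)

offset-suc : ∀ L k → L + + k + 1ℤ ≡ L + + suc k
offset-suc L k = lemma L (+ k)
  where
  lemma : ∀ L x → L + x + 1ℤ ≡ L + (1ℤ + x)
  lemma = solve-∀

δℤ : ℤ → ℤ → ℕ
δℤ = δ ℤP._≟_

δ-offset : ∀ L k u → δℤ (L + + k) (L + + u) ≡ δℕ k u
δ-offset L k u with k ℕ.≟ u
... | yes refl = δ-refl ℤP._≟_ (L + + k)
... | no k≢u = δ-≢ ℤP._≟_ (λ e → k≢u (ℤP.+-injective (∙-cancelˡ L _ _ e)))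

Fits : ℕ → ℤ → ℕ → ℕ → Set
Fits M L e c = c ≤ℕ M × L + + e ≤ + c × + c ≤ L + + e + + M

fits-shift-closed : ∀ M L → ShiftClosed (Fits M L)
fits-shift-closed M L = record { shiftˡ = shiftˡ ; shiftʳ = shiftʳ }
  where
  open ℤP.≤-Reasoning

  suc-hole : ∀ e → L + + suc e ≡ 1ℤ + (L + + e)
  suc-hole e = lemma L (+ e)
    where
    lemma : ∀ L x → L + (1ℤ + x) ≡ 1ℤ + (L + x)
    lemma = solve-∀

  suc-hole′ : ∀ e → L + + suc e + + M ≡ 1ℤ + (L + + e + + M)
  suc-hole′ e = lemma L (+ e) (+ M)
    where
    lemma : ∀ L x M → L + (1ℤ + x) + M ≡ 1ℤ + (L + x + M)
    lemma = solve-∀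

  more-holes : ∀ e → L + + e ≤ L + + suc e
  more-holes e = ℤP.+-monoʳ-≤ L (+≤+ (ℕP.n≤1+n e))

  shiftˡ : ∀ {e c₀ c₁ c} → Fits M L (suc e) c₀ → Fits M L (suc e) c₁ → c₀ ≤ℕ c → c <ℕ c₁ →
           Fits M L e c
  shiftˡ {e} {c₀} {c₁} {c} (_ , lo₀ , _) (c₁≤M , _ , hi₁) c₀≤c c<c₁ =
    ℕP.≤-trans (ℕP.<⇒≤ c<c₁) c₁≤M ,
    ℤP.≤-trans (more-holes e) (ℤP.≤-trans lo₀ (+≤+ c₀≤c)) ,
    +-cancelˡ-≤ 1ℤ (begin
      + suc c              ≤⟨ +≤+ c<c₁ ⟩
      + c₁                 ≤⟨ hi₁ ⟩
      L + + suc e + + M    ≡⟨ suc-hole′ e ⟩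
      1ℤ + (L + + e + + M) ∎)

  shiftʳ : ∀ {e c₀ c₁ c} → Fits M L e c₀ → Fits M L e c₁ → c₀ <ℕ c → c ≤ℕ c₁ → Fits M L (suc e) c
  shiftʳ {e} {c₀} {c₁} {c} (_ , lo₀ , _) (c₁≤M , _ , hi₁) c₀<c c≤c₁ =
    ℕP.≤-trans c≤c₁ c₁≤M ,
    (begin
      L + + suc e    ≡⟨ suc-hole e ⟩
      1ℤ + (L + + e) ≤⟨ ℤP.+-monoʳ-≤ 1ℤ lo₀ ⟩
      + suc c₀       ≤⟨ +≤+ c₀<c ⟩
      + c            ∎) ,
    ℤP.≤-trans (+≤+ c≤c₁) (ℤP.≤-trans hi₁ (ℤP.+-monoˡ-≤ (+ M) (more-holes e)))

fits-displacement : ∀ {M L e c} → Fits M L e c → ∣ L + + e ∣ ≤ℕ M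
fits-displacement (c≤M , lo , hi) = window⇒∣∣≤ lo hi c≤M

_from_ : State → ℤ → ℕ → ℕ
(s from L) k = s (L + + k)

EmptyBelow : State → ℤ → Set
EmptyBelow s L = ∀ x → x < L → s x ≡ 0

module MovedRooms {s : State} {i a b : ℤ} (a<i : a < i) (i′<b : i + 1ℤ < b)
  (si : 1 ≤ℕ s i) (si′ : 1 ≤ℕ s (i + 1ℤ)) where

  private
    i<i′ = i<i+1 i
    a<i′ = ℤP.<-trans a<i i<i′
    i<b = ℤP.<-trans i<i′ i′<b
    a<b = ℤP.<-trans a<i′ i′<b

    leaves-i : ∀ {v} → 1 ≤ℕ v → v ∸ 1 ℕ.+ 1 ℕ.+ 0 ≡ v ℕ.+ 0 ℕ.+ 0
    leaves-i {suc w} _ = lemma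
      where
      lemma : w ℕ.+ 1 ℕ.+ 0 ≡ suc w ℕ.+ 0 ℕ.+ 0
      lemma = solve (w ∷ [])

    leaves-i′ : ∀ {v} → 1 ≤ℕ v → v ∸ 1 ℕ.+ 0 ℕ.+ 1 ≡ v ℕ.+ 0 ℕ.+ 0
    leaves-i′ {suc w} _ = lemma
      where
      lemma : w ℕ.+ 0 ℕ.+ 1 ≡ suc w ℕ.+ 0 ℕ.+ 0
      lemma = solve (w ∷ [])

    enters-a : ∀ v → suc v ℕ.+ 0 ℕ.+ 0 ≡ v ℕ.+ 1 ℕ.+ 0
    enters-a v = solve (v ∷ [])

    enters-b : ∀ v → suc v ℕ.+ 0 ℕ.+ 0 ≡ v ℕ.+ 0 ℕ.+ 1
    enters-b v = solve (v ∷ [])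

  value-balance : ∀ y → moved s i a b y ℕ.+ δℤ y i ℕ.+ δℤ y (i + 1ℤ) ≡ s y ℕ.+ δℤ y a ℕ.+ δℤ y b
  value-balance y with y ℤP.≟ i | y ℤP.≟ (i + 1ℤ) | y ℤP.≟ a | y ℤP.≟ b
  ... | yes refl | no _ | no _ | no _ = leaves-i si
  ... | no _ | yes refl | no _ | no _ = leaves-i′ si′
  ... | no _ | no _ | yes refl | no _ = enters-a (s y)
  ... | no _ | no _ | no _ | yes refl = enters-b (s y)
  ... | no _ | no _ | no _ | no _ = refl
  ... | yes refl | yes p | _ | _ = ⊥-elim (ℤP.<⇒≢ i<i′ p)
  ... | yes refl | _ | yes p | _ = ⊥-elim (ℤP.<⇒≢ a<i (sym p))
  ... | yes refl | _ | _ | yes p = ⊥-elim (ℤP.<⇒≢ i<b p)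
  ... | _ | yes refl | yes p | _ = ⊥-elim (ℤP.<⇒≢ a<i′ (sym p))
  ... | _ | yes refl | _ | yes p = ⊥-elim (ℤP.<⇒≢ i′<b p)
  ... | _ | _ | yes refl | yes p = ⊥-elim (ℤP.<⇒≢ a<b p)

  moved-a : moved s i a b a ≡ suc (s a)
  moved-a = sym (balance-suc arrival (sym (value-balance a)))
    where
    arrival : δℤ a a ℕ.+ δℤ a b ≡ suc (δℤ a i ℕ.+ δℤ a (i + 1ℤ))
    arrival = trans (cong₂ ℕ._+_ (δ-refl ℤP._≟_ a) (δ-≢ ℤP._≟_ (ℤP.<⇒≢ a<b)))
                    (sym (cong suc (cong₂ ℕ._+_ (δ-≢ ℤP._≟_ (ℤP.<⇒≢ a<i)) (δ-≢ ℤP._≟_ (ℤP.<⇒≢ a<i′)))))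

  moved-left-of-a : ∀ {x} → x < a → moved s i a b x ≡ s x
  moved-left-of-a {x} x<a = balance-≡ untouched (value-balance x)
    where
    untouched : δℤ x i ℕ.+ δℤ x (i + 1ℤ) ≡ δℤ x a ℕ.+ δℤ x b
    untouched = cong₂ ℕ._+_
      (trans (δ-≢ ℤP._≟_ (ℤP.<⇒≢ (ℤP.<-trans x<a a<i))) (sym (δ-≢ ℤP._≟_ (ℤP.<⇒≢ x<a))))
      (trans (δ-≢ ℤP._≟_ (ℤP.<⇒≢ (ℤP.<-trans x<a a<i′))) (sym (δ-≢ ℤP._≟_ (ℤP.<⇒≢ (ℤP.<-trans x<a a<b)))))

  moved-≤1 : (∀ x → s x ≤ℕ 1) → s a ≡ 0 → s b ≡ 0 → ∀ x → moved s i a b x ≤ℕ 1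
  moved-≤1 s≤1 sa sb x = ℕP.≤-trans (ℕP.m≤m+n _ _) (ℕP.≤-trans (ℕP.m≤m+n _ _)
    (ℕP.≤-trans (ℕP.≤-reflexive (value-balance x)) arrivals-≤1))
    where
    arrivals-≤1 : s x ℕ.+ δℤ x a ℕ.+ δℤ x b ≤ℕ 1
    arrivals-≤1 with x ℤP.≟ a | x ℤP.≟ b
    ... | yes refl | yes x≡b = ⊥-elim (ℤP.<⇒≢ a<b x≡b)
    ... | yes refl | no _ rewrite sa = ℕP.≤-refl
    ... | no _ | yes refl rewrite sb = ℕP.≤-refl
    ... | no _ | no _ rewrite ℕP.+-identityʳ (s x) | ℕP.+-identityʳ (s x) = s≤1 x

  occ-balance : (∀ x → s x ≤ℕ 1) → (∀ x → moved s i a b x ≤ℕ 1) → ∀ y →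
    occ (moved s i a b y) ℕ.+ δℤ y i ℕ.+ δℤ y (i + 1ℤ) ≡ occ (s y) ℕ.+ δℤ y a ℕ.+ δℤ y b
  occ-balance s≤1 moved≤1 y rewrite occ-≤1 (s≤1 y) | occ-≤1 (moved≤1 y) = value-balance y

  ≤a-of-emptyBelow : ∀ {L} → EmptyBelow (moved s i a b) L → L ≤ a
  ≤a-of-emptyBelow empty′ = ℤP.≮⇒≥ (λ a<L → ℕP.0≢1+n (trans (sym (empty′ a a<L)) moved-a))

  emptyBelow-before : ∀ {L} → EmptyBelow (moved s i a b) L → EmptyBelow s L
  emptyBelow-before empty′ x x<L =
    trans (sym (moved-left-of-a (ℤP.<-≤-trans x<L (≤a-of-emptyBelow empty′)))) (empty′ x x<L)

move-≤1 : ∀ {s t} → (∀ x → s x ≤ℕ 1) → Move s t → ∀ x → t x ≤ℕ 1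
move-≤1 {s} s≤1 (move i a b si si′ a<i sa _ i′<b sb _) = MovedRooms.moved-≤1 {s} a<i i′<b si si′ s≤1 sa sb

placed-after-move : ∀ {M s t} → (∀ x → s x ≤ℕ 1) → Move s t →
  (∀ L → EmptyBelow s L → Placed (Fits M L) (s from L)) →
  ∀ L → EmptyBelow t L → Placed (Fits M L) (t from L)
placed-after-move {M} {s} s≤1 mv@(move i a b si si′ a<i _ a-run i′<b _ b-run) placed L empty′
  with offset L≤a | offset L≤i | offset L≤b
  where
  L≤a = MovedRooms.≤a-of-emptyBelow {s} a<i i′<b si si′ empty′
  L≤i = ℤP.≤-trans L≤a (ℤP.<⇒≤ a<i)
  L≤b = ℤP.≤-trans L≤i (ℤP.<⇒≤ (ℤP.<-trans (i<i+1 i) i′<b))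
... | α , refl | ι , refl | zero , refl =
  ⊥-elim (ℕP.≤⇒≯ z≤n (offset-<⁻¹ L (subst (_< L + + 0) (offset-suc L ι) i′<b)))
... | α , refl | ι , refl | suc ω , refl =
  BlockMove.placed-after α<ι ι<ω block balanceℕ (fits-shift-closed M L)
    (placed L (emptyBelow-before empty′))
  where
  open MovedRooms {s} a<i i′<b si si′
  t = moved s (L + + ι) (L + + α) (L + + suc ω)
  α<ι = offset-<⁻¹ L a<i
  ι<ω = ℕP.≤-pred (offset-<⁻¹ L (subst (_< L + + suc ω) (offset-suc L ι) i′<b))

  block : ∀ k → α <ℕ k → k ≤ℕ ω → 1 ≤ℕ (s from L) k
  block k α<k k≤ω with ℕP.<-cmp k ι
  ... | tri< k<ι _ _ = a-run (L + + k) (offset-< L α<k) (offset-< L k<ι)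
  ... | tri≈ _ refl _ = si
  ... | tri> _ _ ι<k with k ℕ.≟ suc ι
  ...   | yes refl = subst (λ y → 1 ≤ℕ s y) (offset-suc L ι) si′
  ...   | no k≢ι′ = b-run (L + + k)
            (subst (_< L + + k) (sym (offset-suc L ι)) (offset-< L (ℕP.≤∧≢⇒< ι<k (λ e → k≢ι′ (sym e)))))
            (offset-< L (s≤s k≤ω))

  balanceℕ : ∀ k → occ ((t from L) k) ℕ.+ δℕ k ι ℕ.+ δℕ k (suc ι)
                 ≡ occ ((s from L) k) ℕ.+ δℕ k α ℕ.+ δℕ k (suc ω)
  balanceℕ k = begin
    occ (t y) ℕ.+ δℕ k ι ℕ.+ δℕ k (suc ι)
      ≡⟨ cong₂ ℕ._+_ (cong (occ (t y) ℕ.+_) (δ-offset L k ι)) δ-next ⟨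
    occ (t y) ℕ.+ δℤ y (L + + ι) ℕ.+ δℤ y (L + + ι + 1ℤ)
      ≡⟨ occ-balance s≤1 (move-≤1 s≤1 mv) y ⟩
    occ (s y) ℕ.+ δℤ y (L + + α) ℕ.+ δℤ y (L + + suc ω)
      ≡⟨ cong₂ ℕ._+_ (cong (occ (s y) ℕ.+_) (δ-offset L k α)) (δ-offset L k (suc ω)) ⟩
    occ (s y) ℕ.+ δℕ k α ℕ.+ δℕ k (suc ω) ∎
    where
    open ≡-Reasoning
    y = L + + k
    δ-next : δℤ y (L + + ι + 1ℤ) ≡ δℕ k (suc ι)
    δ-next = trans (cong (δℤ y) (offset-suc L ι)) (δ-offset L k (suc ι))

flat-≤1 : ∀ N x → flat N x ≤ℕ 1
flat-≤1 N x with ⌊ 0ℤ ℤP.≤? x ⌋ ∧ ⌊ x ℤP.<? + N ⌋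
... | true = ℕP.≤-refl
... | false = z≤n

flat-negative : ∀ N {x} → x < 0ℤ → flat N x ≡ 0
flat-negative N {x} x<0 with 0ℤ ℤP.≤? x
... | yes 0≤x = ⊥-elim (ℤP.<⇒≱ x<0 0≤x)
... | no _ = refl

flat-inside : ∀ {N m} → m <ℕ N → flat N (+ m) ≡ 1
flat-inside {N} {m} m<N with 0ℤ ℤP.≤? + m | + m ℤP.<? + N
... | yes _ | yes _ = refl
... | no 0≰m | _ = ⊥-elim (0≰m (+≤+ z≤n))
... | yes _ | no m≮N = ⊥-elim (m≮N (+<+ m<N))

flat-outside : ∀ {N m} → N ≤ℕ m → flat N (+ m) ≡ 0
flat-outside {N} {m} N≤m with 0ℤ ℤP.≤? + m | + m ℤP.<? + N
... | _ | yes m<N = ⊥-elim (ℕP.<⇒≱ (ℤP.drop‿+<+ m<N) N≤m)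
... | yes _ | no _ = refl
... | no _ | no _ = refl

nonpositive-offset : ∀ {L} → L ≤ 0ℤ → ∃ λ d → L + + d ≡ 0ℤ
nonpositive-offset {+ zero} _ = 0 , refl
nonpositive-offset {+ suc n} (+≤+ ())
nonpositive-offset { -[1+ n ]} _ = suc n , ℤP.n⊖n≡0 (suc n)

module FlatFrom (N : ℕ) (L : ℤ) (d : ℕ) (L+d≡0 : L + + d ≡ 0ℤ) where

  room : ∀ j → L + + (d ℕ.+ j) ≡ + j
  room j = trans (sym (ℤP.+-assoc L (+ d) (+ j))) (cong (_+ + j) L+d≡0)

  before : ∀ k → k <ℕ d → (flat N from L) k ≡ 0
  before k k<d = flat-negative N (subst (L + + k <_) L+d≡0 (offset-< L k<d))

  after : ∀ {m} → N ≤ℕ m → (flat N from L) (d ℕ.+ m) ≡ 0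
  after {m} N≤m = trans (cong (flat N) (room m)) (flat-outside N≤m)

  filled-flat : ∀ {m} → m ≤ℕ N → filled (flat N from L) (d ℕ.+ m) ≡ m
  filled-flat {m} m≤N = trans
    (filled-run {flat N from L} d (λ j j<m →
      ℕP.≤-reflexive (sym (trans (cong (flat N) (room j)) (flat-inside (ℕP.<-≤-trans j<m m≤N))))))
    (trans (cong (m ℕ.+_) (filled-vacant {flat N from L} before)) (ℕP.+-identityʳ m))

  holes-flat : ∀ {m} → m ≤ℕ N → holes (flat N from L) (d ℕ.+ m) ≡ d
  holes-flat {m} m≤N = ℕP.+-cancelˡ-≡ m _ _ (begin
    m ℕ.+ holes f (d ℕ.+ m)               ≡⟨ cong (ℕ._+ holes f (d ℕ.+ m)) (filled-flat m≤N) ⟨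
    filled f (d ℕ.+ m) ℕ.+ holes f (d ℕ.+ m) ≡⟨ filled+holes f (d ℕ.+ m) ⟩
    d ℕ.+ m                               ≡⟨ ℕP.+-comm d m ⟩
    m ℕ.+ d                               ∎)
    where
    open ≡-Reasoning
    f = flat N from L

  fits : ∀ {m} → m <ℕ N → Fits (N ∸ 1) L d m
  fits m<N = m≤N-1 , ℤP.≤-trans (ℤP.≤-reflexive L+d≡0) (+≤+ z≤n) ,
             ℤP.≤-trans (+≤+ m≤N-1) (ℤP.≤-reflexive (sym (cong (_+ + (N ∸ 1)) L+d≡0)))
    where
    m≤N-1 = ℕP.∸-monoˡ-≤ 1 m<N

flat-placed : ∀ {N} → 1 ≤ℕ N → ∀ L → EmptyBelow (flat N) L → Placed (Fits (N ∸ 1) L) (flat N from L)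
flat-placed {N} 1≤N L empty n occupied with nonpositive-offset L≤0
  where L≤0 = ℤP.≮⇒≥ (λ 0<L → ℕP.0≢1+n (trans (sym (empty 0ℤ 0<L)) (flat-inside 1≤N)))
... | d , L+d≡0 with n ℕ.<? d
...   | yes n<d = ⊥-elim (ℕP.<⇒≱ occupied (ℕP.≤-reflexive (FlatFrom.before N L d L+d≡0 n n<d)))
...   | no n≮d with ℕP.m≤n⇒∃[o]m+o≡n (ℕP.≮⇒≥ n≮d)
...     | m , refl with m ℕ.<? N
...       | no m≮N = ⊥-elim (ℕP.<⇒≱ occupied (ℕP.≤-reflexive (FlatFrom.after N L d L+d≡0 (ℕP.≮⇒≥ m≮N))))
...       | yes m<N =
  subst₂ (Fits (N ∸ 1) L) (sym (holes-flat (ℕP.<⇒≤ m<N))) (sym (filled-flat (ℕP.<⇒≤ m<N))) (fits m<N)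
  where open FlatFrom N L d L+d≡0

WellPlaced : ℕ → State → Set
WellPlaced N s = (∀ x → s x ≤ℕ 1) × (∀ L → EmptyBelow s L → Placed (Fits (N ∸ 1) L) (s from L))

wellPlaced-step : ∀ {N s t} → WellPlaced N s → Move s t → WellPlaced N t
wellPlaced-step (s≤1 , placed) mv = move-≤1 s≤1 mv , placed-after-move s≤1 mv placed

wellPlaced-reachable : ∀ {N s} → 1 ≤ℕ N → Reachable (flat N) s → WellPlaced N s
wellPlaced-reachable {N} 1≤N done = flat-≤1 N , flat-placed 1≤N
wellPlaced-reachable {N} 1≤N (step r mv) = wellPlaced-step {N} (wellPlaced-reachable 1≤N r) mv

countOcc≡filled : ∀ s L n → countOcc s L n ≡ filled (s from L) n
countOcc≡filled s L zero = refl
countOcc≡filled s L (suc n) with s (L + + n)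
... | zero = countOcc≡filled s L n
... | suc _ = cong suc (countOcc≡filled s L n)

countOcc-displacement : ∀ s L n → (L + + n) - + countOcc s L n ≡ L + + holes (s from L) n
countOcc-displacement s L n =
  trans (cong₂ (λ m c → L + + m - + c) (sym (filled+holes (s from L) n)) (countOcc≡filled s L n))
        (cancel L (+ filled (s from L) n) (+ holes (s from L) n))
  where
  cancel : ∀ L x y → L + (x + y) - x ≡ L + y
  cancel = solve-∀

proposition5p12 : (N : ℕ) → 1 ≤ℕ N → (s : State) → Reachable (flat N) s →
    ((x : ℤ) → s x ≤ℕ 1) ×
    ((L : ℤ) → ((x : ℤ) → x < L → s x ≡ 0) → (n : ℕ) → s (L + + n) ≡ 1 →
      ∣ (L + + n) - + countOcc s L n ∣ ≤ℕ N ∸ 1)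
proposition5p12 N 1≤N s reachable with wellPlaced-reachable 1≤N reachable
... | s≤1 , placed = s≤1 , λ L empty n sn →
  subst (λ D → ∣ D ∣ ≤ℕ N ∸ 1) (sym (countOcc-displacement s L n))
        (fits-displacement {L = L} {e = holes (s from L) n} (placed L empty n (ℕP.≤-reflexive (sym sn))))
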